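{- Let $a\geq 4$ and let $k$ be an integer with $2\leq k\leq a/2$. Let $D$ be a strongly connected balanced bipartite digraph of order $2a$ satisfying condition $B_k$. Then $D$ contains a cycle factor.
   Context: Digraphs are finite, without loops and without multiple arcs (2-cycles $x\to y\to x$ are allowed). A digraph is bipartite with partite sets $X,Y$ if every arc has one end in $X$ and the other in $Y$; it is balanced if $|X|=|Y|$. For a vertex $x$, $d(x)=d^+(x)+d^-(x)$ is the sum of its out-degree and in-degree. A pair of distinct vertices $\{x,y\}$ is called dominating if there is a vertex $z$ with $xz\in A(D)$ and $yz\in A(D)$ (a common out-neighbour). A balanced bipartite digraph of order $2a$ satisfies condition $B_k$ if for every dominating pair $\{x,y\}$ we have either ($d(x)\geq 2a-k$ and $d(y)\geq a+k$) or ($d(x)\geq a+k$ and $d(y)\geq 2a-k$). A cycle factor of $D$ is a collection of vertex-disjoint directed cycles whose vertex sets together cover $V(D)$. -}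

module Defs where

open import Data.Nat using (ℕ; zero; suc; _+_; _*_; _∸_; _≤_; _≥_)
open import Data.Bool using (Bool; true; false; T; not; _≟_)
open import Data.Bool.Properties using (T?)
open import Data.Fin using (Fin)
open import Data.Vec using (count; allFin)
open import Data.List using (List; []; _∷_; concat; length)
open import Data.List.Relation.Unary.Unique.Propositional using (Unique)
open import Data.List.Relation.Binary.Permutation.Propositional using (_↭_)
import Data.List as L
open import Data.List.Membership.Propositional using (_∈_)
open import Data.Product using (Σ; _×_; _,_; ∃)
open import Data.Sum using (_⊎_)
open import Data.Empty using (⊥)
open import Relation.Binary.PropositionalEquality using (_≡_; _≢_)

-- Multiple arcs are
-- impossible by construction; 2-cycles x→y→x are allowed.
record Digraph (n : ℕ) : Set where
  field
    arc      : Fin n → Fin n → Bool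
    loopless : ∀ x → arc x x ≡ false

open Digraph public

Arc : ∀ {n} → Digraph n → Fin n → Fin n → Set
Arc D x y = T (arc D x y)

outdeg : ∀ {n} → Digraph n → Fin n → ℕ
outdeg D x = count (λ y → T? (arc D x y)) (allFin _)

indeg : ∀ {n} → Digraph n → Fin n → ℕ
indeg D x = count (λ y → T? (arc D y x)) (allFin _)

deg : ∀ {n} → Digraph n → Fin n → ℕ
deg D x = outdeg D x + indeg D x

IsBipartition : ∀ {n} → Digraph n → (Fin n → Bool) → Set
IsBipartition D side = ∀ x y → Arc D x y → side x ≢ side y

sideSize : ∀ {n} → (Fin n → Bool) → Bool → ℕ
sideSize side b = count (λ x → side x ≟ b) (allFin _)

BalancedBipartite : ∀ {n} → Digraph n → ℕ → Set
BalancedBipartite {n} D a =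
  n ≡ 2 * a ×
  Σ (Fin _ → Bool) λ side →
    IsBipartition D side × sideSize side true ≡ sideSize side false

data Walk {n} (D : Digraph n) : Fin n → Fin n → Set where
  here : ∀ {x} → Walk D x x
  step : ∀ {x y z} → Arc D x y → Walk D y z → Walk D x z

StronglyConnected : ∀ {n} → Digraph n → Set
StronglyConnected D = ∀ x y → Walk D x y

Dominating : ∀ {n} → Digraph n → Fin n → Fin n → Set
Dominating D x y = x ≢ y × ∃ λ z → Arc D x z × Arc D y z

ConditionB : ∀ {n} → Digraph n → ℕ → ℕ → Set
ConditionB D a k = ∀ x y → Dominating D x y →
  (deg D x ≥ 2 * a ∸ k × deg D y ≥ a + k) ⊎
  (deg D x ≥ a + k × deg D y ≥ 2 * a ∸ k)

ArcsFrom : ∀ {n} → Digraph n → Fin n → List (Fin n) → Fin n → Set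
ArcsFrom D x []       last = Arc D x last
ArcsFrom D x (y ∷ ys) last = Arc D x y × ArcsFrom D y ys last

-- a directed cycle v₀ → v₁ → … → v_{m-1} → v₀ given by its (nonempty)
-- list of vertices, which are pairwise distinct.  Since D has no loops,
-- such a cycle automatically has length ≥ 2.
IsCycle : ∀ {n} → Digraph n → List (Fin n) → Set
IsCycle D []       = ⊥
IsCycle D (v ∷ vs) = Unique (v ∷ vs) × ArcsFrom D v vs v

-- a cycle factor: a collection of directed cycles that are vertex-disjoint
-- and together cover V(D); i.e. the concatenation of their vertex lists is
-- a permutation of the list of all vertices.
record CycleFactor {n} (D : Digraph n) : Set where
  field
    cycles  : List (List (Fin n))
    isCycle : ∀ {c} → c ∈ cycles → IsCycle D c
    covers  : concat cycles ↭ L.allFin n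

module Submission where

open import Defs
open import Data.Nat using (ℕ; _≤_; _*_)
open import Data.Nat using (z≤n; s≤s)
open import Data.Nat.Properties using (≤-trans; m≤n*m)
open import Data.Fin using (Fin)
open import Data.Product using (_,_; proj₁; proj₂)
open import Data.Bool using (Bool)
open import Data.Fin.Subset using (∣_∣)
open import Relation.Nullary using (Dec)
open import Relation.Binary.PropositionalEquality using (_≡_)

-- A cycle factor amounts to an injective map F on V(D) with an arc x → F x
-- for every x: the orbits of F are the cycles.  Since D is bipartite, such an
-- F is obtained by matching each side into the other along arcs, and by
-- Hall's theorem these matchings exist as soon as every set S inside one side
-- has at least ∣ S ∣ out-neighbours.  The heart of the proof derives this Hall
-- condition from B_k.  A vertex x lying in no dominating pair is the only
-- in-neighbour of its out-neighbour, so removing x from S costs one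
-- out-neighbour and induction applies.  If all of S lies in dominating pairs
-- but S has fewer out-neighbours than elements, counting degrees of the
-- vertices outside S and outside its out-neighbourhood gives a contradiction.
-- Strong connectivity is used only to give every vertex an out-neighbour, and
-- the argument needs merely a ≥ 1, k ≥ 1 and 2k ≤ a.

module FiniteSubsets where

  open import Data.Nat using (zero; suc; _+_; _≤_; _<_; z≤n; s≤s)
  open import Data.Nat.Properties
    using (+-suc; +-comm; +-identityʳ; m≤m+n; suc-injective; module ≤-Reasoning)
  open import Data.Fin using (zero; suc; _≟_)
  open import Data.Fin.Subset
  open import Data.Fin.Subset.Properties
  open import Data.Vec using ([]; _∷_; tabulate; count; here; there)
  open import Data.Vec.Properties using (lookup∘tabulate; []=⇒lookup; lookup⇒[]=)
  open import Data.Product using (_,_)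
  open import Data.Sum using (inj₁; inj₂)
  open import Function.Base using (_∘_)
  open import Relation.Nullary using (yes; no; does)
  open import Relation.Nullary.Decidable using (dec-true)
  open import Relation.Unary using (Decidable)
  open import Relation.Binary.PropositionalEquality

  subsetOf : ∀ {n} {P : Fin n → Set} → Decidable P → Subset n
  subsetOf P? = tabulate (λ i → does (P? i))

  ∈subsetOf⁺ : ∀ {n} {P : Fin n → Set} (P? : Decidable P) {i : Fin n} → P i → i ∈ subsetOf P?
  ∈subsetOf⁺ P? {i} p =
    lookup⇒[]= i _ (trans (lookup∘tabulate (λ j → does (P? j)) i) (dec-true (P? i) p))

  ∈subsetOf⁻ : ∀ {n} {P : Fin n → Set} (P? : Decidable P) {i : Fin n} → i ∈ subsetOf P? → P i
  ∈subsetOf⁻ P? {i} i∈ with P? i | trans (sym (lookup∘tabulate (λ j → does (P? j)) i)) ([]=⇒lookup i∈)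
  ... | yes p | _ = p
  ... | no _  | ()

  count≡∣subsetOf∣ : ∀ {A : Set} {n} {P : A → Set} (P? : Decidable P) (f : Fin n → A) →
    count P? (tabulate f) ≡ ∣ subsetOf (P? ∘ f) ∣
  count≡∣subsetOf∣ {n = zero}  P? f = refl
  count≡∣subsetOf∣ {n = suc n} P? f with P? (f zero)
  ... | yes _ = cong suc (count≡∣subsetOf∣ P? (f ∘ suc))
  ... | no _  = count≡∣subsetOf∣ P? (f ∘ suc)

  x∈p─q⇒x∉q : ∀ {n} {x : Fin n} (p q : Subset n) → x ∈ p ─ q → x ∉ q
  x∈p─q⇒x∉q (inside ∷ p) (outside ∷ q) here ()
  x∈p─q⇒x∉q (_ ∷ p) (_ ∷ q) (there x∈p─q) (there x∈q) = x∈p─q⇒x∉q p q x∈p─q x∈q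

  x∈p-y⇒x≢y : ∀ {n} {x y : Fin n} (p : Subset n) → x ∈ p - y → x ≢ y
  x∈p-y⇒x≢y {y = y} p x∈ refl = x∈p─q⇒x∉q p ⁅ y ⁆ x∈ (x∈⁅x⁆ y)

  x∈p⇒⁅x⁆⊆p : ∀ {n} {x : Fin n} {p : Subset n} → x ∈ p → ⁅ x ⁆ ⊆ p
  x∈p⇒⁅x⁆⊆p {x = x} {p} x∈p y∈ = subst (_∈ p) (sym (x∈⁅y⁆⇒x≡y x y∈)) x∈p

  ∣p∪q∣+∣p∩q∣≡∣p∣+∣q∣ : ∀ {n} (p q : Subset n) → ∣ p ∪ q ∣ + ∣ p ∩ q ∣ ≡ ∣ p ∣ + ∣ q ∣
  ∣p∪q∣+∣p∩q∣≡∣p∣+∣q∣ [] [] = refl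
  ∣p∪q∣+∣p∩q∣≡∣p∣+∣q∣ (inside ∷ p) (inside ∷ q)
    rewrite +-suc ∣ p ∪ q ∣ ∣ p ∩ q ∣ | +-suc ∣ p ∣ ∣ q ∣ = cong (2 +_) (∣p∪q∣+∣p∩q∣≡∣p∣+∣q∣ p q)
  ∣p∪q∣+∣p∩q∣≡∣p∣+∣q∣ (inside ∷ p) (outside ∷ q) = cong suc (∣p∪q∣+∣p∩q∣≡∣p∣+∣q∣ p q)
  ∣p∪q∣+∣p∩q∣≡∣p∣+∣q∣ (outside ∷ p) (inside ∷ q)
    rewrite +-suc ∣ p ∣ ∣ q ∣ = cong suc (∣p∪q∣+∣p∩q∣≡∣p∣+∣q∣ p q)
  ∣p∪q∣+∣p∩q∣≡∣p∣+∣q∣ (outside ∷ p) (outside ∷ q) = ∣p∪q∣+∣p∩q∣≡∣p∣+∣q∣ p q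

  ∣p∪q∣≤∣p∣+∣q∣ : ∀ {n} (p q : Subset n) → ∣ p ∪ q ∣ ≤ ∣ p ∣ + ∣ q ∣
  ∣p∪q∣≤∣p∣+∣q∣ p q = subst (∣ p ∪ q ∣ ≤_) (∣p∪q∣+∣p∩q∣≡∣p∣+∣q∣ p q) (m≤m+n _ _)

  Empty⇒∣p∣≡0 : ∀ {n} (p : Subset n) → Empty p → ∣ p ∣ ≡ 0
  Empty⇒∣p∣≡0 {n} p e = trans (cong ∣_∣ (Empty-unique e)) (∣⊥∣≡0 n)

  ∣p∪q∣≡∣p∣+∣q∣ : ∀ {n} (p q : Subset n) → Empty (p ∩ q) → ∣ p ∪ q ∣ ≡ ∣ p ∣ + ∣ q ∣
  ∣p∪q∣≡∣p∣+∣q∣ p q disjoint = begin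
    ∣ p ∪ q ∣               ≡⟨ +-identityʳ _ ⟨
    ∣ p ∪ q ∣ + 0           ≡⟨ cong (∣ p ∪ q ∣ +_) (Empty⇒∣p∣≡0 (p ∩ q) disjoint) ⟨
    ∣ p ∪ q ∣ + ∣ p ∩ q ∣   ≡⟨ ∣p∪q∣+∣p∩q∣≡∣p∣+∣q∣ p q ⟩
    ∣ p ∣ + ∣ q ∣           ∎
    where open ≡-Reasoning

  ∣p─q∣+∣p∩q∣≡∣p∣ : ∀ {n} (p q : Subset n) → ∣ p ─ q ∣ + ∣ p ∩ q ∣ ≡ ∣ p ∣
  ∣p─q∣+∣p∩q∣≡∣p∣ [] [] = refl
  ∣p─q∣+∣p∩q∣≡∣p∣ (inside ∷ p) (inside ∷ q) = trans (+-suc _ _) (cong suc (∣p─q∣+∣p∩q∣≡∣p∣ p q))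
  ∣p─q∣+∣p∩q∣≡∣p∣ (inside ∷ p) (outside ∷ q) = cong suc (∣p─q∣+∣p∩q∣≡∣p∣ p q)
  ∣p─q∣+∣p∩q∣≡∣p∣ (outside ∷ p) (inside ∷ q) = ∣p─q∣+∣p∩q∣≡∣p∣ p q
  ∣p─q∣+∣p∩q∣≡∣p∣ (outside ∷ p) (outside ∷ q) = ∣p─q∣+∣p∩q∣≡∣p∣ p q

  ∣p─q∣+∣q∣≡∣p∣ : ∀ {n} (p q : Subset n) → q ⊆ p → ∣ p ─ q ∣ + ∣ q ∣ ≡ ∣ p ∣
  ∣p─q∣+∣q∣≡∣p∣ p q q⊆p =
    trans (cong (λ r → ∣ p ─ q ∣ + ∣ r ∣) (sym p∩q≡q)) (∣p─q∣+∣p∩q∣≡∣p∣ p q)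
    where
    p∩q≡q : p ∩ q ≡ q
    p∩q≡q = ⊆-antisym (p∩q⊆q p q) (λ x∈q → x∈p∩q⁺ (q⊆p x∈q , x∈q))

  suc∣p-x∣≡∣p∣ : ∀ {n} {x : Fin n} (p : Subset n) → x ∈ p → suc ∣ p - x ∣ ≡ ∣ p ∣
  suc∣p-x∣≡∣p∣ {x = x} p x∈p = begin
    suc ∣ p - x ∣          ≡⟨ +-comm 1 _ ⟩
    ∣ p - x ∣ + 1          ≡⟨ cong (∣ p - x ∣ +_) (∣⁅x⁆∣≡1 x) ⟨
    ∣ p - x ∣ + ∣ ⁅ x ⁆ ∣  ≡⟨ ∣p─q∣+∣q∣≡∣p∣ p ⁅ x ⁆ (x∈p⇒⁅x⁆⊆p x∈p) ⟩
    ∣ p ∣                  ∎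
    where open ≡-Reasoning

  ∣p∣≤suc∣p-x∣ : ∀ {n} (x : Fin n) (p : Subset n) → ∣ p ∣ ≤ suc ∣ p - x ∣
  ∣p∣≤suc∣p-x∣ x p = begin
    ∣ p ∣                    ≤⟨ p⊆q⇒∣p∣≤∣q∣ p⊆p-x∪x ⟩
    ∣ (p - x) ∪ ⁅ x ⁆ ∣      ≤⟨ ∣p∪q∣≤∣p∣+∣q∣ (p - x) ⁅ x ⁆ ⟩
    ∣ p - x ∣ + ∣ ⁅ x ⁆ ∣    ≡⟨ cong (∣ p - x ∣ +_) (∣⁅x⁆∣≡1 x) ⟩
    ∣ p - x ∣ + 1            ≡⟨ +-comm _ 1 ⟩
    suc ∣ p - x ∣            ∎
    where
    open ≤-Reasoning
    p⊆p-x∪x : p ⊆ (p - x) ∪ ⁅ x ⁆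
    p⊆p-x∪x {y} y∈p with y ≟ x
    ... | yes refl = x∈p∪q⁺ (inj₂ (x∈⁅x⁆ x))
    ... | no y≢x   = x∈p∪q⁺ (inj₁ (x∈p∧x≢y⇒x∈p-y y∈p y≢x))

  x∈p⇒0<∣p∣ : ∀ {n} {x : Fin n} (p : Subset n) → x ∈ p → 0 < ∣ p ∣
  x∈p⇒0<∣p∣ p x∈p = subst (0 <_) (suc∣p-x∣≡∣p∣ p x∈p) (s≤s z≤n)

  0<∣p∣⇒Nonempty : ∀ {n} (p : Subset n) → 0 < ∣ p ∣ → Nonempty p
  0<∣p∣⇒Nonempty (inside ∷ p)  _ = zero , here
  0<∣p∣⇒Nonempty (outside ∷ p) 0<∣p∣ with 0<∣p∣⇒Nonempty p 0<∣p∣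
  ... | x , x∈p = suc x , there x∈p

  injection⇒∣p∣≤∣q∣ : ∀ {n m} (p : Subset n) (q : Subset m) (φ : Fin n → Fin m) →
    (∀ {x} → x ∈ p → φ x ∈ q) →
    (∀ {x y} → x ∈ p → y ∈ p → φ x ≡ φ y → x ≡ y) → ∣ p ∣ ≤ ∣ q ∣
  injection⇒∣p∣≤∣q∣ p q φ into inj = go ∣ p ∣ p q refl into inj
    where
    go : ∀ s (p : Subset _) (q : Subset _) → ∣ p ∣ ≡ s →
         (∀ {x} → x ∈ p → φ x ∈ q) →
         (∀ {x y} → x ∈ p → y ∈ p → φ x ≡ φ y → x ≡ y) → ∣ p ∣ ≤ ∣ q ∣
    go zero p q ∣p∣≡0 _ _ = subst (_≤ ∣ q ∣) (sym ∣p∣≡0) z≤n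
    go (suc s) p q ∣p∣≡1+s into inj with 0<∣p∣⇒Nonempty p (subst (0 <_) (sym ∣p∣≡1+s) (s≤s z≤n))
    ... | x , x∈p = subst₂ _≤_ (suc∣p-x∣≡∣p∣ p x∈p) (suc∣p-x∣≡∣p∣ q (into x∈p)) (s≤s smaller)
      where
      smaller : ∣ p - x ∣ ≤ ∣ q - φ x ∣
      smaller = go s (p - x) (q - φ x)
        (suc-injective (trans (suc∣p-x∣≡∣p∣ p x∈p) ∣p∣≡1+s))
        (λ y∈ → x∈p∧x≢y⇒x∈p-y (into (p─q⊆p p _ y∈))
                               (λ φy≡φx → x∈p-y⇒x≢y p y∈ (inj (p─q⊆p p _ y∈) x∈p φy≡φx)))
        (λ y∈ z∈ → inj (p─q⊆p p _ y∈) (p─q⊆p p _ z∈))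

module HallsTheorem {n : ℕ} (R : Fin n → Fin n → Set) (R? : ∀ x y → Dec (R x y)) where

  open FiniteSubsets
  open import Data.Nat using (zero; suc; _+_; _<_; z≤n; s≤s; _≤?_)
  open import Data.Nat.Properties
    using (≤-trans; ≤-pred; <⇒≱; ≰⇒>; +-cancelʳ-≤; +-monoʳ-≤; module ≤-Reasoning)
  open import Data.Fin.Properties using (any?)
  open import Data.Fin.Subset
  open import Data.Fin.Subset.Properties
  open import Data.Product using (∃; _×_; _,_; proj₁; proj₂)
  open import Data.Sum using (inj₁; inj₂)
  open import Data.Empty using (⊥-elim)
  open import Relation.Nullary using (yes; no)
  open import Relation.Nullary.Decidable using (_×-dec_)
  open import Relation.Binary.PropositionalEquality

  N : Subset n → Subset n → Subset n
  N A S = subsetOf (λ y → (y ∈? A) ×-dec any? (λ x → (x ∈? S) ×-dec R? x y))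

  ∈N-intro : ∀ {A S x y} → x ∈ S → R x y → y ∈ A → y ∈ N A S
  ∈N-intro {A} {S} x∈S r y∈A =
    ∈subsetOf⁺ (λ y → (y ∈? A) ×-dec any? (λ x → (x ∈? S) ×-dec R? x y)) (y∈A , _ , x∈S , r)

  ∈N-elim : ∀ {A S y} → y ∈ N A S → y ∈ A × ∃ λ x → x ∈ S × R x y
  ∈N-elim {A} {S} = ∈subsetOf⁻ (λ y → (y ∈? A) ×-dec any? (λ x → (x ∈? S) ×-dec R? x y))

  N⊆ : ∀ A S → N A S ⊆ A
  N⊆ A S y∈ = proj₁ (∈N-elim y∈)

  HallCondition : Subset n → Subset n → Set
  HallCondition L A = ∀ S → S ⊆ L → ∣ S ∣ ≤ ∣ N A S ∣

  Matching : Subset n → Subset n → Set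
  Matching L A = ∃ λ (f : Fin n → Fin n) →
    (∀ {x} → x ∈ L → f x ∈ A × R x (f x)) ×
    (∀ {x y} → x ∈ L → y ∈ L → f x ≡ f y → x ≡ y)

  emptyMatching : ∀ L A → Empty L → Matching L A
  emptyMatching L A L≡∅ =
    (λ x → x) , (λ x∈L → ⊥-elim (L≡∅ (_ , x∈L))) , (λ x∈L _ _ → ⊥-elim (L≡∅ (_ , x∈L)))

  singleMatching : ∀ {x y} → R x y → Matching ⁅ x ⁆ ⁅ y ⁆
  singleMatching {x} {y} r = (λ _ → y) , into , same
    where
    into : ∀ {z} → z ∈ ⁅ x ⁆ → y ∈ ⁅ y ⁆ × R z y
    into z∈ rewrite x∈⁅y⁆⇒x≡y x z∈ = x∈⁅x⁆ y , r
    same : ∀ {z w} → z ∈ ⁅ x ⁆ → w ∈ ⁅ x ⁆ → y ≡ y → z ≡ w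
    same z∈ w∈ _ = trans (x∈⁅y⁆⇒x≡y x z∈) (sym (x∈⁅y⁆⇒x≡y x w∈))

  glue : ∀ {L A S B} → B ⊆ A →
    Matching S B → Matching (L ─ S) (A ─ B) → Matching L A
  glue {L} {A} {S} {B} B⊆A (f₁ , into₁ , inj₁') (f₂ , into₂ , inj₂') = f , into , inj
    where
    f : Fin n → Fin n
    f x with x ∈? S
    ... | yes _ = f₁ x
    ... | no _  = f₂ x
    into : ∀ {x} → x ∈ L → f x ∈ A × R x (f x)
    into {x} x∈L with x ∈? S
    ... | yes x∈S = B⊆A (proj₁ (into₁ x∈S)) , proj₂ (into₁ x∈S)
    ... | no x∉S  = let (fx∈ , r) = into₂ (x∈p∧x∉q⇒x∈p─q x∈L x∉S) in p─q⊆p A B fx∈ , r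
    -- values of f₁ lie in B, values of f₂ avoid B
    apart : ∀ {x y} → x ∈ S → y ∈ L → y ∉ S → f₁ x ≢ f₂ y
    apart x∈S y∈L y∉S eq = x∈p─q⇒x∉q A B (proj₁ (into₂ (x∈p∧x∉q⇒x∈p─q y∈L y∉S)))
                                         (subst (_∈ B) eq (proj₁ (into₁ x∈S)))
    inj : ∀ {x y} → x ∈ L → y ∈ L → f x ≡ f y → x ≡ y
    inj {x} {y} x∈L y∈L eq with x ∈? S | y ∈? S
    ... | yes x∈S | yes y∈S = inj₁' x∈S y∈S eq
    ... | no x∉S  | no y∉S  = inj₂' (x∈p∧x∉q⇒x∈p─q x∈L x∉S) (x∈p∧x∉q⇒x∈p─q y∈L y∉S) eq
    ... | yes x∈S | no y∉S  = ⊥-elim (apart x∈S y∈L y∉S eq)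
    ... | no x∉S  | yes y∈S = ⊥-elim (apart y∈S x∈L x∉S (sym eq))

  intoNeighbourhood : ∀ {S A} → Matching S A → Matching S (N A S)
  intoNeighbourhood (f , into , inj) =
    f , (λ x∈S → let (fx∈A , r) = into x∈S in ∈N-intro x∈S r fx∈A , r) , inj

  afterTightSet : ∀ {L A S} → S ⊆ L → ∣ N A S ∣ ≤ ∣ S ∣ →
    HallCondition L A → HallCondition (L ─ S) (A ─ N A S)
  afterTightSet {L} {A} {S} S⊆L tight hallL U U⊆L─S =
    +-cancelʳ-≤ (∣ S ∣) (∣ U ∣) (∣ N (A ─ N A S) U ∣) (begin
      ∣ U ∣ + ∣ S ∣                         ≡⟨ ∣p∪q∣≡∣p∣+∣q∣ U S disjoint ⟨
      ∣ U ∪ S ∣                             ≤⟨ hallL (U ∪ S) U∪S⊆L ⟩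
      ∣ N A (U ∪ S) ∣                       ≤⟨ p⊆q⇒∣p∣≤∣q∣ split ⟩
      ∣ N (A ─ N A S) U ∪ N A S ∣           ≤⟨ ∣p∪q∣≤∣p∣+∣q∣ (N (A ─ N A S) U) (N A S) ⟩
      ∣ N (A ─ N A S) U ∣ + ∣ N A S ∣       ≤⟨ +-monoʳ-≤ _ tight ⟩
      ∣ N (A ─ N A S) U ∣ + ∣ S ∣           ∎)
    where
    open ≤-Reasoning
    U⊆L : U ⊆ L
    U⊆L u∈ = p─q⊆p L S (U⊆L─S u∈)
    disjoint : Empty (U ∩ S)
    disjoint (_ , x∈U∩S) =
      let (x∈U , x∈S) = x∈p∩q⁻ U S x∈U∩S in x∈p─q⇒x∉q L S (U⊆L─S x∈U) x∈S
    U∪S⊆L : U ∪ S ⊆ L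
    U∪S⊆L x∈ with x∈p∪q⁻ U S x∈
    ... | inj₁ x∈U = U⊆L x∈U
    ... | inj₂ x∈S = S⊆L x∈S
    split : N A (U ∪ S) ⊆ N (A ─ N A S) U ∪ N A S
    split {y} y∈ with ∈N-elim y∈ | y ∈? N A S
    ... | _ | yes y∈NS = x∈p∪q⁺ (inj₂ y∈NS)
    ... | y∈A , x , x∈U∪S , r | no y∉NS with x∈p∪q⁻ U S x∈U∪S
    ...   | inj₁ x∈U = x∈p∪q⁺ (inj₁ (∈N-intro x∈U r (x∈p∧x∉q⇒x∈p─q y∈A y∉NS)))
    ...   | inj₂ x∈S = ⊥-elim (y∉NS (∈N-intro x∈S r y∈A))

  NoTightSet : Subset n → Subset n → Set
  NoTightSet L A = ∀ U → U ⊂ L → Nonempty U → ∣ U ∣ < ∣ N A U ∣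

  afterRemovingPair : ∀ {L A x₀} y₀ → x₀ ∈ L → NoTightSet L A →
    HallCondition (L - x₀) (A - y₀)
  afterRemovingPair {L} {A} {x₀} y₀ x₀∈L loose U U⊆L-x₀ with nonempty? U
  ... | no U≡∅ = subst (_≤ ∣ N (A - y₀) U ∣) (sym (Empty⇒∣p∣≡0 U U≡∅)) z≤n
  ... | yes U≢∅ = ≤-pred (begin-strict
      ∣ U ∣                   <⟨ loose U U⊂L U≢∅ ⟩
      ∣ N A U ∣               ≤⟨ ∣p∣≤suc∣p-x∣ y₀ (N A U) ⟩
      suc ∣ N A U - y₀ ∣      ≤⟨ s≤s (p⊆q⇒∣p∣≤∣q∣ shrink) ⟩
      suc ∣ N (A - y₀) U ∣    ∎)
    where
    open ≤-Reasoning
    U⊂L : U ⊂ L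
    U⊂L = (λ u∈ → p─q⊆p L _ (U⊆L-x₀ u∈)) , x₀ , x₀∈L , (λ x₀∈U → x∈p-y⇒x≢y L (U⊆L-x₀ x₀∈U) refl)
    shrink : N A U - y₀ ⊆ N (A - y₀) U
    shrink y∈ with ∈N-elim (p─q⊆p (N A U) _ y∈)
    ... | y∈A , x , x∈U , r = ∈N-intro x∈U r (x∈p∧x≢y⇒x∈p-y y∈A (x∈p-y⇒x≢y (N A U) y∈))

  tight? : ∀ L A S → Dec (S ⊂ L × Nonempty S × ∣ N A S ∣ ≤ ∣ S ∣)
  tight? L A S = (S ⊂? L) ×-dec (nonempty? S ×-dec (∣ N A S ∣ ≤? ∣ S ∣))

  -- Hall's theorem, by induction on an upper bound s of ∣ L ∣: either some
  -- nonempty proper subset S is tight and we match S and L ─ S separately,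
  -- or none is and we match one point x₀ and recurse on L - x₀.
  hall : ∀ s L A → ∣ L ∣ ≤ s → HallCondition L A → Matching L A
  hall zero L A ∣L∣≤0 _ = emptyMatching L A (λ (_ , x∈L) → <⇒≱ (x∈p⇒0<∣p∣ L x∈L) ∣L∣≤0)
  hall (suc s) L A ∣L∣≤1+s hallL with anySubset? (tight? L A)
  ... | yes (S , S⊂L , S≢∅ , tight) =
    glue (N⊆ A S)
      (intoNeighbourhood (hall s S A (smaller (p⊂q⇒∣p∣<∣q∣ S⊂L))
                                     (λ U U⊆S → hallL U (λ u∈ → proj₁ S⊂L (U⊆S u∈)))))
      (hall s (L ─ S) (A ─ N A S)
            (smaller (p∩q≢∅⇒∣p─q∣<∣p∣ L S (_ , x∈p∩q⁺ (proj₁ S⊂L (proj₂ S≢∅) , proj₂ S≢∅))))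
            (afterTightSet (proj₁ S⊂L) tight hallL))
    where
    smaller : ∀ {m} → m < ∣ L ∣ → m ≤ s
    smaller m<∣L∣ = ≤-pred (≤-trans m<∣L∣ ∣L∣≤1+s)
  ... | no noTight with nonempty? L
  ...   | no L≡∅ = emptyMatching L A L≡∅
  ...   | yes (x₀ , x₀∈L) =
    glue (x∈p⇒⁅x⁆⊆p y₀∈A)
         (singleMatching x₀Ry₀)
         (hall s (L - x₀) (A - y₀) (≤-pred (≤-trans (x∈p⇒∣p-x∣<∣p∣ x₀∈L) ∣L∣≤1+s))
               (afterRemovingPair y₀ x₀∈L loose))
    where
    loose : NoTightSet L A
    loose U U⊂L U≢∅ = ≰⇒> (λ tight → noTight (U , U⊂L , U≢∅ , tight))
    -- x₀ has a neighbour in A by the Hall condition for ⁅ x₀ ⁆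
    neighbour : Nonempty (N A ⁅ x₀ ⁆)
    neighbour = 0<∣p∣⇒Nonempty _ (subst (_≤ ∣ N A ⁅ x₀ ⁆ ∣) (∣⁅x⁆∣≡1 x₀)
                  (hallL ⁅ x₀ ⁆ (x∈p⇒⁅x⁆⊆p x₀∈L)))
    y₀ : Fin n
    y₀ = proj₁ neighbour
    y₀∈A : y₀ ∈ A
    y₀∈A = proj₁ (∈N-elim (proj₂ neighbour))
    x₀Ry₀ : R x₀ y₀
    x₀Ry₀ with ∈N-elim (proj₂ neighbour)
    ... | _ , x , x∈ , r = subst (λ z → R z y₀) (x∈⁅y⁆⇒x≡y x₀ x∈) r

module Cycles where

  open import Data.Nat using (zero; suc; _+_; _<_; z≤n; _∸_; _≤?_)
  open import Data.Nat.Properties hiding (_≟_)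
  open import Data.Nat.GeneralisedArithmetic using (fold)
  open import Data.Fin using (_≟_; toℕ)
  open import Data.Fin.Properties using (pigeonhole)
  open import Data.List using (List; []; _∷_; _++_; concat; length; filter; allFin)
  open import Data.List.Properties using (filter-notAll)
  open import Data.List.Relation.Unary.Any using (here; there)
  open import Data.List.Relation.Unary.All as All using (All; []; _∷_)
  open import Data.List.Relation.Unary.AllPairs using ([]; _∷_)
  open import Data.List.Relation.Unary.Unique.Propositional using (Unique)
  import Data.List.Relation.Unary.Unique.Propositional.Properties as Unique
  open import Data.List.Membership.Propositional using (_∈_; _∉_)
  open import Data.List.Membership.Propositional.Properties
    using (∈-filter⁺; ∈-filter⁻; ∈-++⁻; ∈-++⁺ˡ; ∈-++⁺ʳ; ∈-allFin)
  open import Data.List.Membership.Setoid.Properties using (unique⇒irrelevant)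
  open import Data.List.Relation.Binary.Permutation.Propositional using (_↭_)
  open import Data.List.Relation.Binary.BagAndSetEquality using (∼bag⇒↭)
  open import Axiom.UniquenessOfIdentityProofs using (module Decidable⇒UIP)
  open import Function.Base using (_∘_)
  open import Function.Bundles using (mk↔ₛ′)
  open import Data.Product using (∃; _×_; proj₁; proj₂)
  open import Data.Sum using (_⊎_; inj₁; inj₂; [_,_]′)
  open import Data.Empty using (⊥-elim)
  open import Relation.Nullary using (yes; no; ¬_)
  open import Relation.Nullary.Decidable using (_×-dec_; ¬?)
  open import Relation.Binary.PropositionalEquality

  module _ {P : ℕ → Set} (P? : ∀ m → Dec (P m)) where

    LeastWith : ℕ → Set
    LeastWith p = P p × (∀ q → q < p → ¬ P q)

    private
      searchUpTo : ∀ m → (∃ LeastWith) ⊎ (∀ q → q ≤ m → ¬ P q)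
      searchUpTo zero with P? zero
      ... | yes P0 = inj₁ (zero , P0 , λ _ ())
      ... | no ¬P0 = inj₂ λ { zero _ → ¬P0 }
      searchUpTo (suc m) with searchUpTo m
      ... | inj₁ found = inj₁ found
      ... | inj₂ none with P? (suc m)
      ...   | yes Psm = inj₁ (suc m , Psm , λ q q<sm → none q (≤-pred q<sm))
      ...   | no ¬Psm = inj₂ below
        where
        below : ∀ q → q ≤ suc m → ¬ P q
        below q q≤sm with m≤n⇒m<n∨m≡n q≤sm
        ... | inj₁ q<sm = none q (≤-pred q<sm)
        ... | inj₂ refl = ¬Psm

    least : ∀ m → P m → ∃ LeastWith
    least m Pm with searchUpTo m
    ... | inj₁ found = found
    ... | inj₂ none  = ⊥-elim (none m ≤-refl Pm)

  sameMembers⇒↭ : ∀ {n} {xs ys : List (Fin n)} → Unique xs → Unique ys →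
    (∀ {x} → x ∈ xs → x ∈ ys) → (∀ {x} → x ∈ ys → x ∈ xs) → xs ↭ ys
  sameMembers⇒↭ {n} uxs uys to from =
    ∼bag⇒↭ (mk↔ₛ′ to from (λ p → ∈-irrelevant uys _ p) (λ p → ∈-irrelevant uxs _ p))
    where
    ∈-irrelevant : ∀ {zs : List (Fin n)} → Unique zs → ∀ {x} (p q : x ∈ zs) → p ≡ q
    ∈-irrelevant = unique⇒irrelevant (setoid (Fin n)) (Decidable⇒UIP.≡-irrelevant _≟_)

  -- An injective map f with an arc x → f x at every vertex is a permutation
  -- of V(D) whose orbits are directed cycles; together they form a cycle factor.
  module CycleDecomposition {n} (D : Digraph n) (f : Fin n → Fin n)
    (arc-f : ∀ x → Arc D x (f x)) (f-injective : ∀ {x y} → f x ≡ f y → x ≡ y) where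

    open import Data.List.Membership.DecPropositional (_≟_ {n}) using (_∈?_)

    f^ : ℕ → Fin n → Fin n
    f^ i v = fold v f i

    cancelIterates : ∀ {i j} v → i ≤ j → f^ i v ≡ f^ j v → v ≡ f^ (j ∸ i) v
    cancelIterates {i} {j} v i≤j eq = cancel i (trans eq (cong (λ m → f^ m v) (sym (m+[n∸m]≡n i≤j))))
      where
      cancel : ∀ i {k} → f^ i v ≡ f^ (i + k) v → v ≡ f^ k v
      cancel zero    eq = eq
      cancel (suc i) eq = cancel i (f-injective eq)

    Returns : Fin n → ℕ → Set
    Returns v p = 1 ≤ p × f^ p v ≡ v

    -- by pigeonhole on v, f v, …, fⁿ v every vertex returns to itself
    returns : ∀ v → ∃ (Returns v)
    returns v with pigeonhole (n<1+n n) (λ (i : Fin (suc n)) → f^ (toℕ i) v)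
    ... | i , j , i<j , eq = toℕ j ∸ toℕ i , m<n⇒0<n∸m i<j , sym (cancelIterates v (<⇒≤ i<j) eq)

    -- the orbit of v: its least return time p = suc len, and the fact that
    -- v, f v, …, fᵖ⁻¹ v are pairwise distinct
    record Orbit (v : Fin n) : Set where
      field
        len      : ℕ
        closes   : f^ (suc len) v ≡ v
        distinct : ∀ i j → i < j → j < suc len → f^ i v ≢ f^ j v

    orbit : ∀ v → Orbit v
    orbit v with returns v
    ... | p , returns-p with least (λ q → (1 ≤? q) ×-dec (f^ q v ≟ v)) p returns-p
    ...   | suc len , (_ , closes) , minimal = record { len = len ; closes = closes ; distinct = distinct }
      where
      distinct : ∀ i j → i < j → j < suc len → f^ i v ≢ f^ j v
      distinct i j i<j j<p eq =
        minimal (j ∸ i) (≤-<-trans (m∸n≤m j i) j<p) (m<n⇒0<n∸m i<j , sym (cancelIterates v (<⇒≤ i<j) eq))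

    segment : Fin n → ℕ → ℕ → List (Fin n)
    segment v s zero    = []
    segment v s (suc l) = f^ s v ∷ segment v (suc s) l

    ∈segment⁻ : ∀ {x} v s l → x ∈ segment v s l → ∃ λ i → s ≤ i × i < s + l × x ≡ f^ i v
    ∈segment⁻ v s (suc l) (here eq) = s , ≤-refl , subst (s <_) (sym (+-suc s l)) (m≤m+n (suc s) l) , eq
    ∈segment⁻ v s (suc l) (there x∈) with ∈segment⁻ v (suc s) l x∈
    ... | i , s<i , i<s+1+l , eq = i , <⇒≤ s<i , subst (i <_) (sym (+-suc s l)) i<s+1+l , eq

    ∈segment⁺ : ∀ v s l i → s ≤ i → i < s + l → f^ i v ∈ segment v s l
    ∈segment⁺ v s zero    i s≤i i<s+0 = ⊥-elim (<⇒≱ i<s+0 (subst (_≤ i) (sym (+-identityʳ s)) s≤i))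
    ∈segment⁺ v s (suc l) i s≤i i<s+1+l with m≤n⇒m<n∨m≡n s≤i
    ... | inj₂ refl = here refl
    ... | inj₁ s<i  = there (∈segment⁺ v (suc s) l i s<i (subst (i <_) (+-suc s l) i<s+1+l))

    segment-unique : ∀ v s l → (∀ i j → s ≤ i → i < j → j < s + l → f^ i v ≢ f^ j v) →
      Unique (segment v s l)
    segment-unique v s zero    _        = []
    segment-unique v s (suc l) distinct = headFresh ∷ segment-unique v (suc s) l tailDistinct
      where
      headFresh : All (f^ s v ≢_) (segment v (suc s) l)
      headFresh = All.tabulate λ x∈ → let (j , s<j , j<end , eq) = ∈segment⁻ v (suc s) l x∈ in
        λ eq′ → distinct s j ≤-refl s<j (subst (j <_) (sym (+-suc s l)) j<end) (trans eq′ eq)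
      tailDistinct : ∀ i j → suc s ≤ i → i < j → j < suc s + l → f^ i v ≢ f^ j v
      tailDistinct i j s<i i<j j<end = distinct i j (<⇒≤ s<i) i<j (subst (j <_) (sym (+-suc s l)) j<end)

    segment-arcs : ∀ v s l → ArcsFrom D (f^ s v) (segment v (suc s) l) (f^ (suc s + l) v)
    segment-arcs v s zero    = subst (λ m → Arc D (f^ s v) (f^ m v)) (sym (+-identityʳ (suc s))) (arc-f (f^ s v))
    segment-arcs v s (suc l) = arc-f (f^ s v) ,
      subst (λ m → ArcsFrom D (f^ (suc s) v) (segment v (suc (suc s)) l) (f^ m v))
            (sym (+-suc (suc s) l)) (segment-arcs v (suc s) l)

    cycleOf : Fin n → List (Fin n)
    cycleOf v = segment v 0 (suc (Orbit.len (orbit v)))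

    cycleOf-isCycle : ∀ v → IsCycle D (cycleOf v)
    cycleOf-isCycle v = segment-unique v 0 (suc len) (λ i j _ → distinct i j) ,
                        subst (ArcsFrom D v (segment v 1 len)) closes (segment-arcs v 0 len)
      where open Orbit (orbit v)

    cycleOf⁻ : ∀ {x} v → x ∈ cycleOf v → ∃ λ i → x ≡ f^ i v
    cycleOf⁻ v x∈ = let (i , _ , _ , eq) = ∈segment⁻ v 0 _ x∈ in i , eq

    -- … and is closed under f⁻¹, because f is injective and fᵖ v ≡ v
    cycleOf-backClosed : ∀ {x} v → f x ∈ cycleOf v → x ∈ cycleOf v
    cycleOf-backClosed {x} v fx∈ = back (∈segment⁻ v 0 (suc len) fx∈)
      where
      open Orbit (orbit v)
      back : (∃ λ i → 0 ≤ i × i < 0 + suc len × f x ≡ f^ i v) → x ∈ cycleOf v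
      back (zero , _ , _ , fx≡v) =
        subst (_∈ cycleOf v) (sym (f-injective (trans fx≡v (sym closes))))
              (∈segment⁺ v 0 (suc len) len z≤n ≤-refl)
      back (suc i , _ , i<p , fx≡fⁱ⁺¹v) =
        subst (_∈ cycleOf v) (sym (f-injective fx≡fⁱ⁺¹v))
              (∈segment⁺ v 0 (suc len) i z≤n (<-trans (n<1+n i) i<p))

    Closed : List (Fin n) → Set
    Closed xs = ∀ {x} → x ∈ xs → f x ∈ xs

    iterate∈ : ∀ {xs} → Closed xs → ∀ {v} i → v ∈ xs → f^ i v ∈ xs
    iterate∈ closed zero    v∈ = v∈
    iterate∈ closed (suc i) v∈ = closed (iterate∈ closed i v∈)

    record CycleCover (xs : List (Fin n)) : Set where
      field
        cycles   : List (List (Fin n))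
        isCycle  : All (IsCycle D) cycles
        disjoint : Unique (concat cycles)
        sound    : ∀ {x} → x ∈ concat cycles → x ∈ xs
        complete : ∀ {x} → x ∈ xs → x ∈ concat cycles

    outside? : ∀ v x → Dec (x ∉ cycleOf v)
    outside? v x = ¬? (x ∈? cycleOf v)

    offCycle : Fin n → List (Fin n) → List (Fin n)
    offCycle v = filter (outside? v)

    offCycle-closed : ∀ {xs} v → Closed xs → Closed (offCycle v xs)
    offCycle-closed {xs} v closed x∈ =
      let (x∈xs , x∉C) = ∈-filter⁻ (outside? v) {xs = xs} x∈ in
      ∈-filter⁺ (outside? v) (closed x∈xs) (λ fx∈C → x∉C (cycleOf-backClosed v fx∈C))

    addCycle : ∀ {xs} v → v ∈ xs → Closed xs → CycleCover (offCycle v xs) → CycleCover xs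
    addCycle {xs} v v∈ closed rest = record
      { cycles   = cycleOf v ∷ R.cycles
      ; isCycle  = cycleOf-isCycle v ∷ R.isCycle
      ; disjoint = Unique.++⁺ (proj₁ (cycleOf-isCycle v)) R.disjoint
                     (λ (x∈C , x∈R) → proj₂ (off (R.sound x∈R)) x∈C)
      ; sound    = [ onCycle , (λ x∈R → proj₁ (off (R.sound x∈R))) ]′ ∘ ∈-++⁻ (cycleOf v)
      ; complete = complete
      }
      where
      module R = CycleCover rest
      off : ∀ {x} → x ∈ offCycle v xs → x ∈ xs × x ∉ cycleOf v
      off = ∈-filter⁻ (outside? v) {xs = xs}
      onCycle : ∀ {x} → x ∈ cycleOf v → x ∈ xs
      onCycle x∈C = let (i , eq) = cycleOf⁻ v x∈C in subst (_∈ xs) (sym eq) (iterate∈ closed i v∈)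
      complete : ∀ {x} → x ∈ xs → x ∈ cycleOf v ++ concat R.cycles
      complete {x} x∈ with x ∈? cycleOf v
      ... | yes x∈C = ∈-++⁺ˡ x∈C
      ... | no x∉C  = ∈-++⁺ʳ (cycleOf v) (R.complete (∈-filter⁺ (outside? v) x∈ x∉C))

    cover : ∀ k xs → length xs ≤ k → Unique xs → Closed xs → CycleCover xs
    cover k [] _ _ _ = record
      { cycles = [] ; isCycle = [] ; disjoint = [] ; sound = λ () ; complete = λ () }
    cover zero (v ∷ xs) () _ _
    cover (suc k) (v ∷ xs) ∣v∷xs∣≤1+k unique closed =
      addCycle v (here refl) closed
        (cover k (offCycle v (v ∷ xs)) shorter (Unique.filter⁺ (outside? v) unique) (offCycle-closed v closed))
      where
      shorter : length (offCycle v (v ∷ xs)) ≤ k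
      shorter = ≤-pred (≤-trans (filter-notAll (outside? v) (v ∷ xs) (here (λ v∉C → v∉C (here refl))))
                                ∣v∷xs∣≤1+k)

    cycleFactor : CycleFactor D
    cycleFactor = record
      { cycles  = C.cycles
      ; isCycle = All.lookup C.isCycle
      ; covers  = sameMembers⇒↭ C.disjoint (Unique.allFin⁺ n)
                    (λ {x} _ → ∈-allFin x) (λ {x} _ → C.complete (∈-allFin x))
      }
      where
      module C = CycleCover (cover (length (allFin n)) (allFin n) ≤-refl (Unique.allFin⁺ n) (λ {x} _ → ∈-allFin (f x)))

module Arithmetic where

  open import Data.Nat using (_+_; _∸_; _<_)
  open import Data.Nat.Properties
  open import Relation.Binary.PropositionalEquality
  open ≤-Reasoning

  -- under 2k ≤ a the first alternative of B_k implies the second bound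
  a+k≤2a∸k : ∀ a k → 2 * k ≤ a → a + k ≤ 2 * a ∸ k
  a+k≤2a∸k a k 2k≤a = m+n≤o⇒m≤o∸n (a + k) (begin
    a + k + k        ≡⟨ +-assoc a k k ⟩
    a + (k + k)      ≡⟨ cong (λ m → a + (k + m)) (+-identityʳ k) ⟨
    a + 2 * k        ≤⟨ +-monoʳ-≤ a 2k≤a ⟩
    a + a            ≡⟨ cong (a +_) (+-identityʳ a) ⟨
    2 * a            ∎)

  -- a degree ≥ 2a − k with in-degree ≤ a forces out-degree ≥ a − k
  2a∸k≤t+a⇒a≤t+k : ∀ a k t → k ≤ 2 * a → 2 * a ∸ k ≤ t + a → a ≤ t + k
  2a∸k≤t+a⇒a≤t+k a k t k≤2a bound = +-cancelʳ-≤ a a (t + k) (begin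
    a + a            ≡⟨ cong (a +_) (+-identityʳ a) ⟨
    2 * a            ≡⟨ m∸n+n≡m k≤2a ⟨
    2 * a ∸ k + k    ≤⟨ +-monoˡ-≤ k bound ⟩
    t + a + k        ≡⟨ +-assoc t a k ⟩
    t + (a + k)      ≡⟨ cong (t +_) (+-comm a k) ⟩
    t + (k + a)      ≡⟨ +-assoc t k a ⟨
    t + k + a        ∎)

  complement<k : ∀ a k t s z → z + s ≡ a → a ≤ t + k → t < s → z < k
  complement<k a k t s z z+s≡a a≤t+k t<s = +-cancelʳ-< s z k (begin-strict
    z + s            ≡⟨ z+s≡a ⟩
    a                ≤⟨ a≤t+k ⟩
    t + k            <⟨ +-monoˡ-< k t<s ⟩
    s + k            ≡⟨ +-comm s k ⟩
    k + s            ∎)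

  in>k : ∀ a k o i → a + k ≤ o + i → o < a → k < i
  in>k a k o i a+k≤o+i o<a = +-cancelˡ-< o k i (begin-strict
    o + k            <⟨ +-monoˡ-< k o<a ⟩
    a + k            ≤⟨ a+k≤o+i ⟩
    o + i            ∎)

  -- complements in two sets of equal size a reverse inequalities
  complement-antitone : ∀ a w t z s → w + t ≡ a → z + s ≡ a → w ≤ z → s ≤ t
  complement-antitone a w t z s w+t≡a z+s≡a w≤z = +-cancelˡ-≤ z s t (begin
    z + s            ≡⟨ trans z+s≡a (sym w+t≡a) ⟩
    w + t            ≤⟨ +-monoˡ-≤ t w≤z ⟩
    z + t            ∎)

  half : ∀ x a → x + x ≡ 2 * a → x ≡ a
  half x a x+x≡2a = *-cancelˡ-≡ x a 2 (trans (cong (x +_) (+-identityʳ x)) x+x≡2a)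

module Digraphs where

  open FiniteSubsets
  open Cycles using (module CycleDecomposition)
  open Arithmetic using (half)
  open import Data.Nat using (suc; _+_; _∸_)
  open import Data.Nat.Properties using (≤-refl; m∸n+n≡m)
  open import Data.Bool using (Bool; true; false; not) renaming (_≟_ to _≟B_)
  open import Data.Bool.Properties using (T?; ¬-not; not-¬; not-involutive; not-injective)
  open import Data.Fin using (zero; suc)
  open import Data.Fin.Subset
  open import Data.Fin.Subset.Properties
  open import Data.Product using (∃; proj₁; proj₂)
  open import Data.Empty using (⊥-elim)
  open import Function.Base using (id)
  open import Relation.Nullary using (yes; no)
  open import Relation.Binary.PropositionalEquality

  -- In a strongly connected digraph on at least two vertices every vertex has
  -- an out-neighbour: the first arc of a walk to some other vertex.
  outNeighbour : ∀ {n} (D : Digraph n) → StronglyConnected D → 2 ≤ n → ∀ x → ∃ (Arc D x)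
  outNeighbour D sc (s≤s (s≤s z≤n)) x = firstArc (sc x (other x)) (x≢other x)
    where
    other : ∀ {m} → Fin (suc (suc m)) → Fin (suc (suc m))
    other zero    = suc zero
    other (suc _) = zero
    x≢other : ∀ {m} (x : Fin (suc (suc m))) → x ≢ other x
    x≢other zero    ()
    x≢other (suc _) ()
    firstArc : ∀ {x y} → Walk D x y → x ≢ y → ∃ (Arc D x)
    firstArc here       x≢x = ⊥-elim (x≢x refl)
    firstArc (step r _) _   = _ , r

  module Neighbourhoods {n} (D : Digraph n) where

    arc? : ∀ x y → Dec (Arc D x y)
    arc? x y = T? (arc D x y)

    open HallsTheorem (Arc D) arc? public

    N⁺ : Subset n → Subset n
    N⁺ S = N ⊤ S

    outNbrs inNbrs : Fin n → Subset n
    outNbrs x = subsetOf (arc? x)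
    inNbrs  x = subsetOf (λ y → arc? y x)

    outdeg≤ : ∀ x P → outNbrs x ⊆ P → outdeg D x ≤ ∣ P ∣
    outdeg≤ x P ⊆P = subst (_≤ ∣ P ∣) (sym (count≡∣subsetOf∣ (arc? x) id)) (p⊆q⇒∣p∣≤∣q∣ ⊆P)

    indeg≤ : ∀ x P → inNbrs x ⊆ P → indeg D x ≤ ∣ P ∣
    indeg≤ x P ⊆P = subst (_≤ ∣ P ∣) (sym (count≡∣subsetOf∣ (λ y → arc? y x) id)) (p⊆q⇒∣p∣≤∣q∣ ⊆P)

    arcOut : ∀ {x y} → y ∈ outNbrs x → Arc D x y
    arcOut {x} = ∈subsetOf⁻ (arc? x)

    arcIn : ∀ {x y} → y ∈ inNbrs x → Arc D y x
    arcIn {x} = ∈subsetOf⁻ (λ y → arc? y x)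

    outNbrs⊆N⁺ : ∀ {S x} → x ∈ S → outNbrs x ⊆ N⁺ S
    outNbrs⊆N⁺ x∈S y∈ = ∈N-intro x∈S (arcOut y∈) ∈⊤

  module Bipartite {n} (D : Digraph n) (side : Fin n → Bool) (bipartite : IsBipartition D side) where

    open Neighbourhoods D

    X : Bool → Subset n
    X b = subsetOf (λ x → side x ≟B b)

    ∈X⁺ : ∀ {x b} → side x ≡ b → x ∈ X b
    ∈X⁺ {b = b} = ∈subsetOf⁺ (λ x → side x ≟B b)

    ∈X⁻ : ∀ {x b} → x ∈ X b → side x ≡ b
    ∈X⁻ {b = b} = ∈subsetOf⁻ (λ x → side x ≟B b)

    head-side : ∀ {x y} → Arc D x y → side y ≡ not (side x)
    head-side {x} {y} r = ¬-not (λ eq → bipartite x y r (sym eq))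

    tail-side : ∀ {x y} → Arc D x y → side x ≡ not (side y)
    tail-side {x} {y} r = ¬-not (bipartite x y r)

    head∈ : ∀ {b x y} → x ∈ X (not b) → Arc D x y → y ∈ X b
    head∈ {b} x∈ r = ∈X⁺ (trans (head-side r) (trans (cong not (∈X⁻ x∈)) (not-involutive b)))

    tail∈ : ∀ {b x y} → y ∈ X (not b) → Arc D x y → x ∈ X b
    tail∈ {b} y∈ r = ∈X⁺ (trans (tail-side r) (trans (cong not (∈X⁻ y∈)) (not-involutive b)))

    N⁺⊆ : ∀ {b S} → S ⊆ X b → N⁺ S ⊆ X (not b)
    N⁺⊆ S⊆X y∈ with ∈N-elim y∈
    ... | _ , x , x∈S , r = ∈X⁺ (trans (head-side r) (cong not (∈X⁻ (S⊆X x∈S))))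

    -- Hall's condition for the out-neighbourhoods on both sides yields a cycle
    -- factor: matchings of each side along arcs combine to an injective map
    -- x ↦ F x with x → F x, as F x always lies on the other side from x.
    hall⇒cycleFactor : (∀ b S → S ⊆ X b → ∣ S ∣ ≤ ∣ N⁺ S ∣) → CycleFactor D
    hall⇒cycleFactor hallX = CycleDecomposition.cycleFactor D F arc-F F-injective
      where
      M : ∀ b → Matching (X b) ⊤
      M b = hall ∣ X b ∣ (X b) ⊤ ≤-refl (hallX b)
      F : Fin n → Fin n
      F x = proj₁ (M (side x)) x
      arc-F : ∀ x → Arc D x (F x)
      arc-F x = proj₂ (proj₁ (proj₂ (M (side x))) (∈X⁺ refl))
      sameSide : ∀ {x y} → side x ≡ side y → F x ≡ F y → x ≡ y
      sameSide {x} {y} eq Fx≡Fy = proj₂ (proj₂ (M (side x))) (∈X⁺ refl) (∈X⁺ (sym eq))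
        (subst (λ b → proj₁ (M (side x)) x ≡ proj₁ (M b) y) (sym eq) Fx≡Fy)
      F-injective : ∀ {x y} → F x ≡ F y → x ≡ y
      F-injective {x} {y} Fx≡Fy with side x ≟B side y
      ... | yes eq = sameSide eq Fx≡Fy
      ... | no neq = ⊥-elim (neq (not-injective (trans (sym (head-side (arc-F x)))
                                    (trans (cong side Fx≡Fy) (head-side (arc-F y))))))

    balanced⇒∣X∣≡a : ∀ {a} → n ≡ 2 * a → sideSize side true ≡ sideSize side false → ∀ b → ∣ X b ∣ ≡ a
    balanced⇒∣X∣≡a {a} n≡2a balanced = sides
      where
      t : ℕ
      t = ∣ X true ∣
      X-false≡∁X-true : X false ≡ ∁ (X true)
      X-false≡∁X-true = ⊆-antisym
        (λ y∈ → x∉p⇒x∈∁p (λ y∈X → not-¬ (∈X⁻ y∈X) (∈X⁻ y∈)))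
        (λ y∈ → ∈X⁺ (¬-not (λ eq → x∈∁p⇒x∉p y∈ (∈X⁺ eq))))
      ∣X-false∣ : ∣ X false ∣ ≡ n ∸ t
      ∣X-false∣ = trans (cong ∣_∣ X-false≡∁X-true) (∣∁p∣≡n∸∣p∣ (X true))
      t≡n∸t : t ≡ n ∸ t
      t≡n∸t = trans (sym (count≡∣subsetOf∣ (λ x → side x ≟B true) id))
                (trans balanced (trans (count≡∣subsetOf∣ (λ x → side x ≟B false) id) ∣X-false∣))
      t≡a : t ≡ a
      t≡a = half t a (begin
        t + t          ≡⟨ cong (_+ t) t≡n∸t ⟩
        n ∸ t + t      ≡⟨ m∸n+n≡m (∣p∣≤n (X true)) ⟩
        n              ≡⟨ n≡2a ⟩
        2 * a          ∎)
        where open ≡-Reasoning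
      sides : ∀ b → ∣ X b ∣ ≡ a
      sides true  = t≡a
      sides false = trans ∣X-false∣ (trans (sym t≡n∸t) t≡a)

module ConditionBHall {n} (D : Digraph n) (side : Fin n → Bool) (bipartite : IsBipartition D side)
  (a k : ℕ) (1≤k : 1 ≤ k) (2k≤a : 2 * k ≤ a)
  (∣X∣≡a : ∀ b → ∣ Digraphs.Bipartite.X D side bipartite b ∣ ≡ a)
  (out : Fin n → Fin n) (arc-out : ∀ x → Arc D x (out x))
  (condB : ConditionB D a k) where

  open FiniteSubsets
  open Arithmetic
  open Digraphs
  open Neighbourhoods D
  open Bipartite D side bipartite
  open import Data.Nat using (zero; suc; _+_; _∸_; _<_; _≤?_)
  open import Data.Nat.Properties hiding (_≟_)
  open import Data.Bool using (not)
  open import Data.Fin using (_≟_)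
  open import Data.Fin.Properties using (any?)
  open import Data.Fin.Subset
  open import Data.Fin.Subset.Properties
  open import Data.Product using (∃; _×_)
  open import Data.Sum using (inj₁; inj₂)
  open import Data.Empty using (⊥-elim) renaming (⊥ to False)
  open import Relation.Nullary using (yes; no; ¬_)
  open import Relation.Nullary.Decidable using (_×-dec_; ¬?)
  open import Relation.Binary.PropositionalEquality

  InDominatingPair : Fin n → Set
  InDominatingPair x = ∃ (Dominating D x)

  inDominatingPair? : ∀ x → Dec (InDominatingPair x)
  inDominatingPair? x = any? (λ y → ¬? (x ≟ y) ×-dec any? (λ z → arc? x z ×-dec arc? y z))

  -- all neighbours of x lie on the other side, which has a vertices
  outdeg≤a : ∀ x → outdeg D x ≤ a
  outdeg≤a x = subst (outdeg D x ≤_) (∣X∣≡a _) (outdeg≤ x _ (λ y∈ → ∈X⁺ (head-side (arcOut y∈))))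

  indeg≤a : ∀ x → indeg D x ≤ a
  indeg≤a x = subst (indeg D x ≤_) (∣X∣≡a _) (indeg≤ x _ (λ y∈ → ∈X⁺ (tail-side (arcIn y∈))))

  k≤2a : k ≤ 2 * a
  k≤2a = ≤-trans (m≤n*m k 2) (≤-trans 2k≤a (m≤n*m a 2))

  -- by B_k a vertex of a dominating pair has degree ≥ a + k, as 2a − k ≥ a + k
  deg≥a+k : ∀ {x} → InDominatingPair x → a + k ≤ deg D x
  deg≥a+k {x} (y , dom) with condB x y dom
  ... | inj₁ (big , _) = ≤-trans (a+k≤2a∸k a k 2k≤a) big
  ... | inj₂ (big , _) = big

  sameOut⇒dominating : ∀ {x y} → x ≢ y → out x ≡ out y → Dominating D x y
  sameOut⇒dominating {x} {y} x≢y eq = x≢y , out x , arc-out x , subst (Arc D y) (sym eq) (arc-out y)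

  soleInNeighbour : ∀ {x y} → ¬ InDominatingPair x → Arc D y (out x) → y ≡ x
  soleInNeighbour {x} {y} low r with y ≟ x
  ... | yes y≡x = y≡x
  ... | no y≢x  = ⊥-elim (low (y , (λ x≡y → y≢x (sym x≡y)) , out x , arc-out x , r))

  indeg-out≤1 : ∀ {x} → ¬ InDominatingPair x → indeg D (out x) ≤ 1
  indeg-out≤1 {x} low = subst (indeg D (out x) ≤_) (∣⁅x⁆∣≡1 x)
    (indeg≤ (out x) ⁅ x ⁆ (λ y∈ → subst (_∈ ⁅ x ⁆) (sym (soleInNeighbour low (arcIn y∈))) (x∈⁅x⁆ x)))

  out-injectiveAt : ∀ {x y} → ¬ InDominatingPair x → out x ≡ out y → x ≡ y
  out-injectiveAt {x} {y} low eq = sym (soleInNeighbour low (subst (Arc D y) (sym eq) (arc-out y)))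

  -- so removing such an x from S loses the out-neighbour out x
  N⁺-shrinks : ∀ {S x} → x ∈ S → ¬ InDominatingPair x → ∣ N⁺ (S - x) ∣ < ∣ N⁺ S ∣
  N⁺-shrinks {S} {x} x∈S low = p⊂q⇒∣p∣<∣q∣ (smaller , out x , ∈N-intro x∈S (arc-out x) ∈⊤ , lost)
    where
    smaller : N⁺ (S - x) ⊆ N⁺ S
    smaller z∈ with ∈N-elim z∈
    ... | _ , y , y∈ , r = ∈N-intro (p─q⊆p S _ y∈) r ∈⊤
    lost : out x ∉ N⁺ (S - x)
    lost z∈ with ∈N-elim z∈
    ... | _ , y , y∈ , r = x∈p-y⇒x≢y S y∈ (soleInNeighbour low r)

  module Deficient {b S} (S⊆X : S ⊆ X b) (dominating : ∀ {x} → x ∈ S → InDominatingPair x)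
                   (deficient : ∣ N⁺ S ∣ < ∣ S ∣) where

    T : Subset n
    T = N⁺ S

    -- out is not injective on S, so two vertices of S dominate and one of
    -- them has degree at least 2a − k
    bigVertex : ∃ λ x → x ∈ S × 2 * a ∸ k ≤ deg D x
    bigVertex with any? (λ x → any? (λ y → (x ∈? S) ×-dec ((y ∈? S) ×-dec (¬? (x ≟ y) ×-dec (out x ≟ out y)))))
    ... | yes (x , y , x∈S , y∈S , x≢y , eq) with condB x y (sameOut⇒dominating x≢y eq)
    ...   | inj₁ (big , _) = x , x∈S , big
    ...   | inj₂ (_ , big) = y , y∈S , big
    bigVertex | no noCollision =
      ⊥-elim (<⇒≱ deficient (injection⇒∣p∣≤∣q∣ S T out (λ x∈ → ∈N-intro x∈ (arc-out _) ∈⊤) injective))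
      where
      injective : ∀ {x y} → x ∈ S → y ∈ S → out x ≡ out y → x ≡ y
      injective {x} {y} x∈S y∈S eq with x ≟ y
      ... | yes x≡y = x≡y
      ... | no x≢y  = ⊥-elim (noCollision (x , y , x∈S , y∈S , x≢y , eq))

    -- its out-neighbours lie in T, so T is nearly all of its side
    a≤∣T∣+k : a ≤ ∣ T ∣ + k
    a≤∣T∣+k = let (x , x∈S , big) = bigVertex in
      2a∸k≤t+a⇒a≤t+k a k (∣ T ∣) k≤2a
        (≤-trans big (+-mono-≤ (outdeg≤ x T (outNbrs⊆N⁺ x∈S)) (indeg≤a x)))

    Z W : Subset n
    Z = X b ─ S
    W = X (not b) ─ T

    ∣Z∣+∣S∣≡a : ∣ Z ∣ + ∣ S ∣ ≡ a
    ∣Z∣+∣S∣≡a = trans (∣p─q∣+∣q∣≡∣p∣ (X b) S S⊆X) (∣X∣≡a b)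

    ∣W∣+∣T∣≡a : ∣ W ∣ + ∣ T ∣ ≡ a
    ∣W∣+∣T∣≡a = trans (∣p─q∣+∣q∣≡∣p∣ (X (not b)) T (N⁺⊆ S⊆X)) (∣X∣≡a (not b))

    ∣Z∣<k : ∣ Z ∣ < k
    ∣Z∣<k = complement<k a k (∣ T ∣) (∣ S ∣) (∣ Z ∣) ∣Z∣+∣S∣≡a a≤∣T∣+k deficient

    -- a vertex of W has no in-neighbour in S (else it would be in T) …
    inNbrs-W⊆Z : ∀ {w} → w ∈ W → inNbrs w ⊆ Z
    inNbrs-W⊆Z w∈W y∈ = x∈p∧x∉q⇒x∈p─q (tail∈ (p─q⊆p _ _ w∈W) (arcIn y∈))
      (λ y∈S → x∈p─q⇒x∉q _ T w∈W (∈N-intro y∈S (arcIn y∈) ∈⊤))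

    -- … so its degree is below a + k and it lies in no dominating pair
    W-low : ∀ {w} → w ∈ W → ¬ InDominatingPair w
    W-low {w} w∈W dom = <⇒≱ (+-mono-≤-< (outdeg≤a w) (≤-<-trans (indeg≤ w Z (inNbrs-W⊆Z w∈W)) ∣Z∣<k))
                            (deg≥a+k dom)

    -- out maps W into Z: out w is on the side of S, and is not in S, since a
    -- vertex of S has out-degree ≤ ∣ T ∣ < a, hence in-degree > k ≥ 1
    out-W⊆Z : ∀ {w} → w ∈ W → out w ∈ Z
    out-W⊆Z {w} w∈W = x∈p∧x∉q⇒x∈p─q (head∈ (p─q⊆p _ _ w∈W) (arc-out w)) out-w∉S
      where
      out-w∉S : out w ∉ S
      out-w∉S out-w∈S = <⇒≱ (≤-<-trans 1≤k k<indeg) (indeg-out≤1 (W-low w∈W))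
        where
        ∣T∣<a : ∣ T ∣ < a
        ∣T∣<a = <-≤-trans deficient (subst (∣ S ∣ ≤_) (∣X∣≡a b) (p⊆q⇒∣p∣≤∣q∣ S⊆X))
        k<indeg : k < indeg D (out w)
        k<indeg = in>k a k _ _ (deg≥a+k (dominating out-w∈S))
                    (≤-<-trans (outdeg≤ (out w) T (outNbrs⊆N⁺ out-w∈S)) ∣T∣<a)

    ∣W∣≤∣Z∣ : ∣ W ∣ ≤ ∣ Z ∣
    ∣W∣≤∣Z∣ = injection⇒∣p∣≤∣q∣ W Z out out-W⊆Z (λ w∈W _ → out-injectiveAt (W-low w∈W))

    -- but then ∣ S ∣ ≤ ∣ T ∣, contradicting deficiency
    absurd : False
    absurd = <⇒≱ deficient (complement-antitone a (∣ W ∣) (∣ T ∣) (∣ Z ∣) (∣ S ∣) ∣W∣+∣T∣≡a ∣Z∣+∣S∣≡a ∣W∣≤∣Z∣)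

  -- Hall's condition, by induction on ∣ S ∣: vertices in no dominating pair
  -- are removed one at a time, and what remains is handled by Deficient.
  hallCondition : ∀ b S → S ⊆ X b → ∣ S ∣ ≤ ∣ N⁺ S ∣
  hallCondition b S = byInduction ∣ S ∣ S ≤-refl
    where
    byInduction : ∀ s S → ∣ S ∣ ≤ s → S ⊆ X b → ∣ S ∣ ≤ ∣ N⁺ S ∣
    byInduction zero S ∣S∣≤0 _ = ≤-trans ∣S∣≤0 z≤n
    byInduction (suc s) S ∣S∣≤1+s S⊆X with any? (λ x → (x ∈? S) ×-dec ¬? (inDominatingPair? x))
    ... | yes (x , x∈S , low) = begin
      ∣ S ∣                ≡⟨ suc∣p-x∣≡∣p∣ S x∈S ⟨
      suc ∣ S - x ∣        ≤⟨ s≤s (byInduction s (S - x) smaller (λ y∈ → S⊆X (p─q⊆p S _ y∈))) ⟩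
      suc ∣ N⁺ (S - x) ∣   ≤⟨ N⁺-shrinks x∈S low ⟩
      ∣ N⁺ S ∣             ∎
      where
      open ≤-Reasoning
      smaller : ∣ S - x ∣ ≤ s
      smaller = ≤-pred (≤-trans (x∈p⇒∣p-x∣<∣p∣ x∈S) ∣S∣≤1+s)
    ... | no noneLow with ∣ S ∣ ≤? ∣ N⁺ S ∣
    ...   | yes hallS = hallS
    ...   | no ¬hallS = ⊥-elim (Deficient.absurd S⊆X dominating (≰⇒> ¬hallS))
      where
      dominating : ∀ {x} → x ∈ S → InDominatingPair x
      dominating {x} x∈S with inDominatingPair? x
      ... | yes dom = dom
      ... | no low  = ⊥-elim (noneLow (x , x∈S , low))

-- The theorem: strong connectivity supplies the out-neighbour choice, the
-- balance gives sides of size a, and B_k gives Hall's condition on both sides.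
theorem1p10 : (a k : ℕ) → 4 ≤ a → 2 ≤ k → 2 * k ≤ a →
    (D : Digraph (2 * a)) → StronglyConnected D → BalancedBipartite D a →
    ConditionB D a k → CycleFactor D
theorem1p10 a k 4≤a 2≤k 2k≤a D strong (n≡2a , side , bipartite , balanced) condB =
  hall⇒cycleFactor hallCondition
  where
  open Digraphs using (outNeighbour; module Bipartite)
  open Bipartite D side bipartite using (hall⇒cycleFactor; balanced⇒∣X∣≡a)
  2≤2a : 2 ≤ 2 * a
  2≤2a = ≤-trans (≤-trans (s≤s (s≤s z≤n)) 4≤a) (m≤n*m a 2)
  out : Fin (2 * a) → Fin (2 * a)
  out x = proj₁ (outNeighbour D strong 2≤2a x)
  open ConditionBHall D side bipartite a k (≤-trans (s≤s z≤n) 2≤k) 2k≤a (balanced⇒∣X∣≡a n≡2a balanced)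
                      out (λ x → proj₂ (outNeighbour D strong 2≤2a x)) condB
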